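{- Let $E$ be a finite set and $\tau:2^{E}\to2^{E}$ an operator, and for $A\subseteq E$ let $ex(A)=\{x\in A: x\notin\tau(A\setminus\{x\})\}$. (a) If $\tau$ satisfies (C1) $X\subseteq\tau(X)$ for all $X$ and (C22) for all $F\subseteq G\subseteq E$ with $G\subseteq\tau(F)$, $\tau(G)=\tau(F)$ (a violator space), then for every $A\subseteq E$ and $x\in A$: $x\in ex(A)$ if and only if $\tau(A)\neq\tau(A\setminus\{x\})$. (b) If $\tau$ satisfies (C1) and (Convexity) for all $X\subseteq Y\subseteq Z\subseteq E$ with $\tau(X)=\tau(Z)$ we have $\tau(Y)=\tau(X)=\tau(Z)$ (a convex space), then for every $A\subseteq E$ and $x\in A$: $x\in ex(A)$ implies $\tau(A)\neq\tau(A\setminus\{x\})$. -}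

module Defs where

open import Data.Nat using (ℕ)
open import Data.Fin using (Fin)
open import Data.Fin.Subset using (Subset; _∈_; _∉_; _⊆_; _-_)
open import Data.Product using (_×_)
open import Relation.Binary.PropositionalEquality using (_≡_)

C1 : {n : ℕ} → (Subset n → Subset n) → Set
C1 τ = ∀ X → X ⊆ τ X

C22 : {n : ℕ} → (Subset n → Subset n) → Set
C22 τ = ∀ F G → F ⊆ G → G ⊆ τ F → τ G ≡ τ F

Convexity : {n : ℕ} → (Subset n → Subset n) → Set
Convexity τ = ∀ X Y Z → X ⊆ Y → Y ⊆ Z → τ X ≡ τ Z → (τ Y ≡ τ X) × (τ Y ≡ τ Z)

_∈ex[_]_ : {n : ℕ} → Fin n → (Subset n → Subset n) → Subset n → Set
x ∈ex[ τ ] A = (x ∈ A) × (x ∉ τ (A - x))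

-- * One direction needs only extensivity (C1): if τ(A) = τ(A ∖ {x}) then
--   x ∈ A ⊆ τ(A) = τ(A ∖ {x}), so x is not extreme.  This proves part (b)
--   outright and the forward half of part (a).
-- * For the converse in a violator space, suppose x ∈ τ(A ∖ {x}).  Then by
--   (C1) all of A lies in τ(A ∖ {x}), and (C22) applied to A ∖ {x} ⊆ A gives
--   τ(A) = τ(A ∖ {x}).  Contrapositively, a change of closure forces x to be
--   extreme.
module Submission where

open import Defs
open import Data.Nat using (ℕ)
open import Data.Fin using (Fin; _≟_)
open import Data.Fin.Subset using (Subset; _∈_; _⊆_; _-_; ⁅_⁆)
open import Data.Fin.Subset.Properties using (p─q⊆p; x∈p∧x≢y⇒x∈p-y)
open import Data.Product using (_×_; _,_)
open import Function.Bundles using (_⇔_; mk⇔)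
open import Relation.Nullary using (yes; no)
open import Relation.Binary.PropositionalEquality using (_≡_; _≢_; refl; subst)

module _ {n : ℕ} (τ : Subset n → Subset n) where

  extreme⇒closure-changes : C1 τ → ∀ A x → x ∈ex[ τ ] A → τ A ≢ τ (A - x)
  extreme⇒closure-changes c1 A x (x∈A , x∉τ[A-x]) τA≡τ[A-x] =
    x∉τ[A-x] (subst (x ∈_) τA≡τ[A-x] (c1 A x∈A))

  recovered⇒A⊆closure : C1 τ → ∀ A x → x ∈ τ (A - x) → A ⊆ τ (A - x)
  recovered⇒A⊆closure c1 A x x∈τ[A-x] {y} y∈A with y ≟ x
  ... | yes refl = x∈τ[A-x]
  ... | no  y≢x  = c1 (A - x) (x∈p∧x≢y⇒x∈p-y y∈A y≢x)

  recovered⇒closure-unchanged :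
    C1 τ → C22 τ → ∀ A x → x ∈ τ (A - x) → τ A ≡ τ (A - x)
  recovered⇒closure-unchanged c1 c22 A x x∈τ[A-x] =
    c22 (A - x) A (p─q⊆p A ⁅ x ⁆) (recovered⇒A⊆closure c1 A x x∈τ[A-x])

  closure-changes⇒extreme :
    C1 τ → C22 τ → ∀ A x → x ∈ A → τ A ≢ τ (A - x) → x ∈ex[ τ ] A
  closure-changes⇒extreme c1 c22 A x x∈A τA≢τ[A-x] =
    x∈A , λ x∈τ[A-x] → τA≢τ[A-x] (recovered⇒closure-unchanged c1 c22 A x x∈τ[A-x])

mainTheorem13 : (n : ℕ) → (τ : Subset n → Subset n)
    → ((C1 τ → C22 τ → ∀ (A : Subset n) (x : Fin n) → x ∈ A → (x ∈ex[ τ ] A ⇔ τ A ≢ τ (A - x)))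
    × (C1 τ → Convexity τ → ∀ (A : Subset n) (x : Fin n) → x ∈ A → x ∈ex[ τ ] A → τ A ≢ τ (A - x)))
mainTheorem13 n τ = violator , convex
  where
  violator : C1 τ → C22 τ → ∀ A x → x ∈ A → (x ∈ex[ τ ] A ⇔ τ A ≢ τ (A - x))
  violator c1 c22 A x x∈A =
    mk⇔ (extreme⇒closure-changes τ c1 A x) (closure-changes⇒extreme τ c1 c22 A x x∈A)

  convex : C1 τ → Convexity τ → ∀ A x → x ∈ A → x ∈ex[ τ ] A → τ A ≢ τ (A - x)
  convex c1 _ A x _ = extreme⇒closure-changes τ c1 A x
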